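{- Let $n\ge1$, $\pi\in\mathfrak S_n(132)$ and $\sigma\in\mathfrak S_n(123)$. Then $\mathrm{KRi}(\pi)=\sigma$ if and only if for all $i,a\in\{1,\dots,n\}$: $$(i,a)\in\mathrm{LMIN}(\pi)\iff(a,i)\in\mathrm{LMIN}(\sigma).$$
   Context: Permutations are words $a_1\dots a_n$ with $a_i=\pi(i)$; $\mathfrak S_n(\tau)$ denotes $\tau$-avoiding permutations ($123$: no $i<j<k$ with $a_i<a_j<a_k$; $132$: no $i<j<k$ with $a_i<a_k<a_j$). $\mathrm{LMIN}(\pi)=\{(i,a_i): a_i<a_j\text{ for all }j<i\}$. $\mathcal D_n$ is the set of Dyck paths of semilength $n$ as words in $u,d$, with up-steps indexed $u_1,\dots,u_n$ and down-steps $d_1,\dots,d_n$ from left to right. The standard bijection $f:\mathfrak S_n(132)\to\mathcal D_n$ is defined recursively (on $132$-avoiding words of distinct integers, depending only on relative order) by $f(\epsilon)=\epsilon$ and $f(\pi_L\,m\,\pi_R)=u\,f(\pi_L)\,d\,f(\pi_R)$ where $m$ is the largest letter. Richards' map $\mathrm{Ri}:\mathcal D_n\to\mathfrak S_n(123)$ builds $a_1\dots a_n$ by scanning down-steps $d_1,\dots,d_n$ left to right: if $d_i$ is immediately preceded by an up-step $u_j$, set $a_{n+1-j}:=i$; otherwise set $a_j:=i$ for the largest $j$ with $a_j$ not yet set. The Knuth–Richards bijection is $\mathrm{KRi}=\mathrm{Ri}\circ f:\mathfrak S_n(132)\to\mathfrak S_n(123)$; e.g. $\mathrm{KRi}(6743125)=5743612$.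 -}

module Defs where

open import Data.Nat using (ℕ; zero; suc; _+_; _∸_; _<_; _≤_; _≡ᵇ_; _⊔_)
open import Data.Bool using (Bool; true; false; if_then_else_)
open import Data.List using (List; []; _∷_; _++_; length; map; replicate; upTo; foldr; [_])
open import Data.Maybe using (Maybe; just; nothing; maybe; fromMaybe)
open import Data.Product using (_×_; _,_; ∃-syntax)
open import Relation.Nullary using (¬_)
open import Relation.Binary.PropositionalEquality using (_≡_; refl)
open import Data.List.Relation.Binary.Permutation.Propositional using (_↭_)
open import Data.List.Relation.Binary.Sublist.Propositional using (_⊆_)

IsPerm : ℕ → List ℕ → Set
IsPerm n w = w ↭ map suc (upTo n)

Avoids123 : List ℕ → Set
Avoids123 w = ¬ (∃[ a ] ∃[ b ] ∃[ c ] ((a ∷ b ∷ c ∷ []) ⊆ w × a < b × b < c))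

Avoids132 : List ℕ → Set
Avoids132 w = ¬ (∃[ a ] ∃[ b ] ∃[ c ] ((a ∷ b ∷ c ∷ []) ⊆ w × a < c × c < b))

-- 1-based lookup: at w i = just aᵢ if 1 ≤ i ≤ length w.
at : List ℕ → ℕ → Maybe ℕ
at []       _             = nothing
at (x ∷ xs) zero          = nothing
at (x ∷ xs) (suc zero)    = just x
at (x ∷ xs) (suc (suc i)) = at xs (suc i)

IsLMin : List ℕ → ℕ → ℕ → Set
IsLMin w i a = (at w i ≡ just a) × (∀ j b → j < i → at w j ≡ just b → a < b)

data Step : Set where
  u d : Step

breakAt : ℕ → List ℕ → List ℕ × List ℕ
breakAt m [] = [] , []
breakAt m (x ∷ xs) with x ≡ᵇ m
... | true  = [] , xs
... | false with breakAt m xs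
...   | (L , R) = x ∷ L , R

maxL : List ℕ → ℕ
maxL = foldr _⊔_ 0

-- f(ε) = ε, f(π_L m π_R) = u f(π_L) d f(π_R), m the largest letter
-- (fuel = length guarantees termination).
fAux : ℕ → List ℕ → List Step
fAux zero    _        = []
fAux (suc k) []       = []
fAux (suc k) (x ∷ xs) with breakAt (maxL (x ∷ xs)) (x ∷ xs)
... | (L , R) = u ∷ fAux k L ++ d ∷ fAux k R

f : List ℕ → List Step
f w = fAux (length w) w

-- Richards' map.  Positions are 1-based.
setAt : List (Maybe ℕ) → ℕ → ℕ → List (Maybe ℕ)
setAt []       _             v = []
setAt (x ∷ xs) zero          v = x ∷ xs
setAt (x ∷ xs) (suc zero)    v = just v ∷ xs
setAt (x ∷ xs) (suc (suc k)) v = x ∷ setAt xs (suc k) v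

lastNothing : List (Maybe ℕ) → Maybe ℕ
lastNothing [] = nothing
lastNothing (x ∷ xs) with lastNothing xs
... | just k  = just (suc k)
... | nothing = maybe (λ _ → nothing) (just 1) x

setLast : List (Maybe ℕ) → ℕ → List (Maybe ℕ)
setLast arr v = maybe (λ k → setAt arr k v) arr (lastNothing arr)

-- riAux n prevIsUp j i path arr : j = number of up-steps read so far
-- (so a preceding up-step is u_j), i = number of down-steps read so far.
riAux : ℕ → Bool → ℕ → ℕ → List Step → List (Maybe ℕ) → List (Maybe ℕ)
riAux n _    j i []       arr = arr
riAux n _    j i (u ∷ p) arr = riAux n true (suc j) i p arr
riAux n prev j i (d ∷ p) arr =
  riAux n false j (suc i) p
    (if prev then setAt arr (suc n ∸ j) (suc i) else setLast arr (suc i))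

Ri : ℕ → List Step → List ℕ
Ri n p = map (fromMaybe 0) (riAux n false 0 0 p (replicate n nothing))

KRi : List ℕ → List ℕ
KRi w = Ri (length w) (f w)

-- sanity check from the paper
KRi-example : KRi (6 ∷ 7 ∷ 4 ∷ 3 ∷ 1 ∷ 2 ∷ 5 ∷ []) ≡ (5 ∷ 7 ∷ 4 ∷ 3 ∷ 6 ∷ 1 ∷ 2 ∷ [])
KRi-example = refl

-- For a permutation π of 1…n let m t = min (n+1, π₁, …, π_t).  If π avoids 132, writing π = π_L n π_R
-- puts every letter of π_L above every letter of π_R, and induction along this split shows that in f π
-- exactly n+1 ∸ m t up-steps precede the t-th down-step.  So the t-th down-step follows an up-step iff
-- m t < m (t ∸ 1), i.e. iff (t , m t) ∈ LMIN π, and Richards' map then writes t at position m t; every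
-- other t goes to the rightmost free position, which lies right of m t.  Hence LMIN (KRi π) is the
-- transpose of LMIN π, and the entries of KRi π off its left-to-right minima decrease.  The entries of a
-- 123-avoiding permutation off its left-to-right minima decrease too, and two permutations with this
-- property and the same left-to-right minima coincide.

module Submission where

open import Defs
open import Data.Nat using (ℕ; zero; suc; pred; _+_; _∸_; _<_; _≤_; _⊓_; z≤n; s≤s; _≤?_; _<?_; _≟_; _≡ᵇ_)
open import Data.Nat.Properties
open import Data.Bool using (true; false; T)
open import Data.List using (List; []; _∷_; _++_; length; map; replicate; upTo; foldl; [_]; filter; take; drop)
open import Data.List.Properties
  using (length-++; length-map; length-replicate; length-take; length-upTo; map-++; map-∘; map-cong-local;
         ++-assoc; upTo-∷ʳ; take++drop≡id; filter-++; filter-all; filter-none; filter-accept)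
open import Data.List.Relation.Unary.All using ([]; _∷_)
import Data.List.Relation.Unary.All as All
open import Data.List.Relation.Unary.AllPairs using ([]; _∷_)
open import Data.List.Relation.Unary.Any using (here; there)
open import Data.List.Relation.Unary.Unique.Propositional using (Unique)
open import Data.List.Relation.Unary.Unique.Propositional.Properties using (map⁺; upTo⁺)
open import Data.List.Membership.Propositional using (_∈_)
open import Data.List.Membership.Propositional.Properties
  using (∈-map⁺; ∈-map⁻; ∈-++⁺ˡ; ∈-++⁺ʳ; ∈-upTo⁺; ∈-upTo⁻)
open import Data.List.Relation.Binary.Permutation.Propositional using (↭-sym; ↭⇒↭ₛ)
open import Data.List.Relation.Binary.Permutation.Propositional.Properties using (filter-↭; ↭-length; ∈-resp-↭)
import Data.List.Relation.Binary.Permutation.Setoid.Properties as SetoidPerm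
open import Data.List.Relation.Binary.Sublist.Propositional
  using (_⊆_; []; _∷_; _∷ʳ_; ⊆-trans; ⊆-refl; minimum; from∈)
open import Data.List.Relation.Binary.Sublist.Propositional.Properties using (++⁺; ++⁺ˡ; ++⁺ʳ; All-resp-⊆)
open import Data.Maybe using (Maybe; just; nothing; maybe; fromMaybe)
open import Data.Maybe.Properties using (just-injective)
open import Data.Nat.Induction using (<-rec)
open import Data.Product using (_×_; _,_; ∃-syntax; proj₁; proj₂)
open import Data.Sum using (_⊎_; inj₁; inj₂; map₂)
import Data.Sum as Sum
open import Data.Empty using (⊥-elim)
open import Function using (_∘_)
open import Relation.Nullary using (¬_; Dec; yes; no; contradiction)
open import Relation.Binary.Definitions using (tri<; tri≈; tri>)
open import Relation.Binary.PropositionalEquality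
  using (_≡_; _≢_; ≢-sym; refl; sym; trans; cong; cong₂; subst; subst₂; setoid; module ≡-Reasoning)
open import Function.Bundles using (_⇔_; mk⇔; Equivalence)

-- Positions in lists

at-zero : ∀ xs → at xs 0 ≡ nothing
at-zero []       = refl
at-zero (x ∷ xs) = refl

at-just⇒1≤ : ∀ xs i {y} → at xs i ≡ just y → 1 ≤ i
at-just⇒1≤ (x ∷ xs) (suc i) _ = s≤s z≤n

at-just⇒≤length : ∀ xs i {y} → at xs i ≡ just y → i ≤ length xs
at-just⇒≤length (x ∷ xs) (suc zero)    _ = s≤s z≤n
at-just⇒≤length (x ∷ xs) (suc (suc i)) e = s≤s (at-just⇒≤length xs (suc i) e)

at-just⇒∈ : ∀ xs i {y} → at xs i ≡ just y → y ∈ xs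
at-just⇒∈ (x ∷ xs) (suc zero)    refl = here refl
at-just⇒∈ (x ∷ xs) (suc (suc i)) e    = there (at-just⇒∈ xs (suc i) e)

∈⇒at-just : ∀ xs {y} → y ∈ xs → ∃[ i ] at xs i ≡ just y
∈⇒at-just (x ∷ xs) (here refl) = 1 , refl
∈⇒at-just (x ∷ xs) (there y∈xs) with ∈⇒at-just xs y∈xs
... | suc i , e = suc (suc i) , e
... | zero  , e = contradiction (trans (sym (at-zero xs)) e) λ ()

at-defined : ∀ xs i → 1 ≤ i → i ≤ length xs → ∃[ y ] at xs i ≡ just y
at-defined (x ∷ xs) (suc zero)    _ _         = x , refl
at-defined (x ∷ xs) (suc (suc i)) _ (s≤s i≤) = at-defined xs (suc i) (s≤s z≤n) i≤

at-beyond : ∀ xs i → length xs < i → at xs i ≡ nothing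
at-beyond []       i             _         = refl
at-beyond (x ∷ xs) (suc zero)    (s≤s ())
at-beyond (x ∷ xs) (suc (suc i)) (s≤s len<) = at-beyond xs (suc i) len<

at-extensional : ∀ xs ys → (∀ i → at xs i ≡ at ys i) → xs ≡ ys
at-extensional []       []       _  = refl
at-extensional []       (y ∷ ys) eq with () ← eq 1
at-extensional (x ∷ xs) []       eq with () ← eq 1
at-extensional (x ∷ xs) (y ∷ ys) eq with refl ← eq 1 = cong (x ∷_) (at-extensional xs ys eq′)
  where
  eq′ : ∀ i → at xs i ≡ at ys i
  eq′ zero    = trans (at-zero xs) (sym (at-zero ys))
  eq′ (suc i) = eq (suc (suc i))

drop≡∷⇒at : ∀ xs t {x rest} → drop t xs ≡ x ∷ rest →
            at xs (suc t) ≡ just x × drop (suc t) xs ≡ rest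
drop≡∷⇒at (y ∷ ys) zero    refl = refl , refl
drop≡∷⇒at (y ∷ ys) (suc t) e    = drop≡∷⇒at ys t e

∈-take⇒at : ∀ xs k {y} → y ∈ take k xs → ∃[ j ] (j ≤ k × at xs j ≡ just y)
∈-take⇒at (x ∷ xs) (suc k) (here refl) = 1 , s≤s z≤n , refl
∈-take⇒at (x ∷ xs) (suc k) (there y∈) with ∈-take⇒at xs k y∈
... | suc j , j≤k , e = suc (suc j) , s≤s j≤k , e
... | zero  , _   , e = contradiction (trans (sym (at-zero xs)) e) λ ()

at-<⇒⊆ : ∀ xs i j {a b} → at xs i ≡ just a → at xs j ≡ just b → i < j → (a ∷ b ∷ []) ⊆ xs
at-<⇒⊆ (x ∷ xs) (suc zero)    (suc zero)    _    _  (s≤s ())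
at-<⇒⊆ (x ∷ xs) (suc zero)    (suc (suc j)) refl eb _         = refl ∷ from∈ (at-just⇒∈ xs (suc j) eb)
at-<⇒⊆ (x ∷ xs) (suc (suc i)) (suc (suc j)) ea   eb (s≤s i<j) = x ∷ʳ at-<⇒⊆ xs (suc i) (suc j) ea eb i<j

at-<-<⇒⊆ : ∀ xs i j k {a b c} → at xs i ≡ just a → at xs j ≡ just b → at xs k ≡ just c →
           i < j → j < k → (a ∷ b ∷ c ∷ []) ⊆ xs
at-<-<⇒⊆ (x ∷ xs) (suc zero) (suc zero) _ _ _ _ (s≤s ()) _
at-<-<⇒⊆ (x ∷ xs) (suc zero) (suc (suc j)) (suc (suc k)) refl eb ec _ (s≤s j<k) =
  refl ∷ at-<⇒⊆ xs (suc j) (suc k) eb ec j<k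
at-<-<⇒⊆ (x ∷ xs) (suc (suc i)) (suc (suc j)) (suc (suc k)) ea eb ec (s≤s i<j) (s≤s j<k) =
  x ∷ʳ at-<-<⇒⊆ xs (suc i) (suc j) (suc k) ea eb ec i<j j<k

Unique⇒at-injective : ∀ {xs} → Unique xs → ∀ i j {y} →
                      at xs i ≡ just y → at xs j ≡ just y → i ≡ j
Unique⇒at-injective (_ ∷ _) (suc zero) (suc zero) _ _ = refl
Unique⇒at-injective {x ∷ xs} (x∉ ∷ xs-unique) (suc zero) (suc (suc j)) refl e =
  contradiction refl (All.lookup x∉ (at-just⇒∈ xs (suc j) e))
Unique⇒at-injective {x ∷ xs} (x∉ ∷ xs-unique) (suc (suc i)) (suc zero) e refl =
  contradiction refl (All.lookup x∉ (at-just⇒∈ xs (suc i) e))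
Unique⇒at-injective (x∉ ∷ xs-unique) (suc (suc i)) (suc (suc j)) e e′ =
  cong suc (Unique⇒at-injective xs-unique (suc i) (suc j) e e′)

Unique-resp-⊇ : ∀ {xs ys : List ℕ} → xs ⊆ ys → Unique ys → Unique xs
Unique-resp-⊇ []           _            = []
Unique-resp-⊇ (y ∷ʳ xs⊆ys) (_ ∷ ys!)    = Unique-resp-⊇ xs⊆ys ys!
Unique-resp-⊇ (refl ∷ xs⊆ys) (y∉ ∷ ys!) = All-resp-⊆ xs⊆ys y∉ ∷ Unique-resp-⊇ xs⊆ys ys!

Unique⇒pair-≢ : ∀ {a b ys} → Unique ys → (a ∷ b ∷ []) ⊆ ys → a ≢ b
Unique⇒pair-≢ ys! sub with (a≢b ∷ []) ∷ _ ← Unique-resp-⊇ sub ys! = a≢b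

Avoids132-resp-⊇ : ∀ {xs ys} → xs ⊆ ys → Avoids132 ys → Avoids132 xs
Avoids132-resp-⊇ xs⊆ys avoids (a , b , c , sub , a<c , c<b) =
  avoids (a , b , c , ⊆-trans sub xs⊆ys , a<c , c<b)

-- Counting and permutations

count≥ : ℕ → List ℕ → ℕ
count≥ c xs = length (filter (c ≤?_) xs)

count≥-++ : ∀ c xs ys → count≥ c (xs ++ ys) ≡ count≥ c xs + count≥ c ys
count≥-++ c xs ys = trans (cong length (filter-++ (c ≤?_) xs ys)) (length-++ (filter (c ≤?_) xs))

count≥-all : ∀ c xs → (∀ {z} → z ∈ xs → c ≤ z) → count≥ c xs ≡ length xs
count≥-all c xs c≤ = cong length (filter-all (c ≤?_) (All.tabulate c≤))

count≥-none : ∀ c xs → (∀ {z} → z ∈ xs → z < c) → count≥ c xs ≡ 0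
count≥-none c xs <c = cong length (filter-none (c ≤?_) (All.tabulate (<⇒≱ ∘ <c)))

count≥-∷-≤ : ∀ {c x} xs → c ≤ x → count≥ c (x ∷ xs) ≡ suc (count≥ c xs)
count≥-∷-≤ xs c≤x = cong length (filter-accept (_ ≤?_) c≤x)

count≥-take : ∀ c k xs → count≥ c (take k xs) ≤ count≥ c xs
count≥-take c k xs = subst (count≥ c (take k xs) ≤_)
  (trans (sym (count≥-++ c (take k xs) (drop k xs))) (cong (count≥ c) (take++drop≡id k xs)))
  (m≤m+n _ _)

count≥-1…n : ∀ c n → count≥ (suc c) (map suc (upTo n)) ≡ n ∸ c
count≥-1…n c zero    = sym (0∸n≡0 c)
count≥-1…n c (suc n) = begin
  count≥ (suc c) (map suc (upTo (suc n)))
    ≡⟨ cong (count≥ (suc c) ∘ map suc) (sym (upTo-∷ʳ n)) ⟩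
  count≥ (suc c) (map suc (upTo n ++ [ n ]))
    ≡⟨ cong (count≥ (suc c)) (map-++ suc (upTo n) [ n ]) ⟩
  count≥ (suc c) (map suc (upTo n) ++ [ suc n ])
    ≡⟨ count≥-++ (suc c) (map suc (upTo n)) [ suc n ] ⟩
  count≥ (suc c) (map suc (upTo n)) + count≥ (suc c) [ suc n ]
    ≡⟨ cong (_+ count≥ (suc c) [ suc n ]) (count≥-1…n c n) ⟩
  n ∸ c + count≥ (suc c) [ suc n ]
    ≡⟨ last-step (c ≤? n) ⟩
  suc n ∸ c ∎
  where
  open ≡-Reasoning
  last-step : Dec (c ≤ n) → n ∸ c + count≥ (suc c) [ suc n ] ≡ suc n ∸ c
  last-step (yes c≤n) = begin
    n ∸ c + count≥ (suc c) [ suc n ] ≡⟨ cong (λ ys → n ∸ c + length ys)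
                                                (filter-accept (suc c ≤?_) (s≤s c≤n)) ⟩
    n ∸ c + 1                        ≡⟨ +-comm (n ∸ c) 1 ⟩
    suc (n ∸ c)                      ≡⟨ sym (+-∸-assoc 1 c≤n) ⟩
    suc n ∸ c                        ∎
  last-step (no c≰n) = begin
    n ∸ c + count≥ (suc c) [ suc n ] ≡⟨ cong₂ _+_ (m≤n⇒m∸n≡0 (<⇒≤ n<c))
                                                 (count≥-none (suc c) [ suc n ] λ { (here refl) → s≤s n<c }) ⟩
    0                                ≡⟨ sym (m≤n⇒m∸n≡0 n<c) ⟩
    suc n ∸ c                        ∎
    where n<c = ≰⇒> c≰n

module _ {n π} (perm : IsPerm n π) where

  IsPerm⇒length : length π ≡ n
  IsPerm⇒length = trans (↭-length perm) (trans (length-map suc (upTo n)) (length-upTo n))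

  IsPerm⇒∈-bounded : ∀ {y} → y ∈ π → 1 ≤ y × y ≤ n
  IsPerm⇒∈-bounded y∈π with ∈-map⁻ suc (∈-resp-↭ perm y∈π)
  ... | x , x<n , refl = s≤s z≤n , ∈-upTo⁻ x<n

  IsPerm⇒∋ : ∀ {y} → 1 ≤ y → y ≤ n → y ∈ π
  IsPerm⇒∋ {suc y} _ y<n = ∈-resp-↭ (↭-sym perm) (∈-map⁺ suc (∈-upTo⁺ y<n))

  IsPerm⇒Unique : Unique π
  IsPerm⇒Unique =
    SetoidPerm.Unique-resp-↭ (setoid ℕ) (↭⇒↭ₛ (↭-sym perm)) (map⁺ suc-injective (upTo⁺ n))

  IsPerm⇒count≥ : ∀ c → 1 ≤ c → count≥ c π ≡ suc n ∸ c
  IsPerm⇒count≥ (suc c) _ = trans (↭-length (filter-↭ (suc c ≤?_) perm)) (count≥-1…n c n)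

-- Left-to-right minima

-- A permutation of 1…n described through lookups; unlike IsPerm, it is easy to establish for the
-- output of Richards' map.
record OneLine (n : ℕ) (τ : List ℕ) : Set where
  field
    length≡   : length τ ≡ n
    bounded   : ∀ {w y} → at τ w ≡ just y → 1 ≤ y × y ≤ n
    onto      : ∀ {y} → 1 ≤ y → y ≤ n → ∃[ w ] at τ w ≡ just y
    injective : ∀ {w w′ y} → at τ w ≡ just y → at τ w′ ≡ just y → w ≡ w′

  positioned : ∀ {w y} → at τ w ≡ just y → 1 ≤ w × w ≤ n
  positioned {w} e = at-just⇒1≤ τ w e , subst (w ≤_) length≡ (at-just⇒≤length τ w e)

  defined : ∀ {w} → 1 ≤ w → w ≤ n → ∃[ y ] at τ w ≡ just y
  defined {w} 1≤w w≤n = at-defined τ w 1≤w (subst (w ≤_) (sym length≡) w≤n)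

  undefined : ∀ {w} → n < w → at τ w ≡ nothing
  undefined {w} n<w = at-beyond τ w (subst (_< w) (sym length≡) n<w)

IsPerm⇒OneLine : ∀ {n π} → IsPerm n π → OneLine n π
IsPerm⇒OneLine {π = π} perm = record
  { length≡   = IsPerm⇒length perm
  ; bounded   = λ {w} e → IsPerm⇒∈-bounded perm (at-just⇒∈ π w e)
  ; onto      = λ 1≤y y≤n → ∈⇒at-just π (IsPerm⇒∋ perm 1≤y y≤n)
  ; injective = λ {w} {w′} → Unique⇒at-injective (IsPerm⇒Unique perm) w w′
  }

prefixMin : ℕ → List ℕ → ℕ → ℕ
prefixMin s []       t       = s
prefixMin s (x ∷ xs) zero    = s
prefixMin s (x ∷ xs) (suc t) = prefixMin (s ⊓ x) xs t

prefixMin-zero : ∀ s xs → prefixMin s xs 0 ≡ s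
prefixMin-zero s []       = refl
prefixMin-zero s (x ∷ xs) = refl

prefixMin-≤ : ∀ s xs t → prefixMin s xs t ≤ s
prefixMin-≤ s []       t       = ≤-refl
prefixMin-≤ s (x ∷ xs) zero    = ≤-refl
prefixMin-≤ s (x ∷ xs) (suc t) = ≤-trans (prefixMin-≤ (s ⊓ x) xs t) (m⊓n≤m s x)

prefixMin-suc-≤ : ∀ s xs t → prefixMin s xs (suc t) ≤ prefixMin s xs t
prefixMin-suc-≤ s []       t       = ≤-refl
prefixMin-suc-≤ s (x ∷ xs) zero    = ≤-trans (prefixMin-≤ (s ⊓ x) xs 0) (m⊓n≤m s x)
prefixMin-suc-≤ s (x ∷ xs) (suc t) = prefixMin-suc-≤ (s ⊓ x) xs t

prefixMin-antitone : ∀ s xs {t t′} → t ≤ t′ → prefixMin s xs t′ ≤ prefixMin s xs t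
prefixMin-antitone s xs {t′ = zero}  z≤n = ≤-refl
prefixMin-antitone s xs {t′ = suc t′} t≤ with m≤n⇒m<n∨m≡n t≤
... | inj₂ refl = ≤-refl
... | inj₁ t<   = ≤-trans (prefixMin-suc-≤ s xs t′) (prefixMin-antitone s xs (≤-pred t<))

prefixMin-≤-at : ∀ s xs {j t b} → at xs j ≡ just b → j ≤ t → prefixMin s xs t ≤ b
prefixMin-≤-at s (x ∷ xs) {suc zero}    {suc t} refl _ = ≤-trans (prefixMin-≤ (s ⊓ x) xs t) (m⊓n≤n s x)
prefixMin-≤-at s (x ∷ xs) {suc (suc j)} {suc t} e (s≤s j≤t) = prefixMin-≤-at (s ⊓ x) xs e j≤t

prefixMin-attained : ∀ s xs t →
                     prefixMin s xs t ≡ s ⊎ ∃[ j ] (j ≤ t × at xs j ≡ just (prefixMin s xs t))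
prefixMin-attained s []       t       = inj₁ refl
prefixMin-attained s (x ∷ xs) zero    = inj₁ refl
prefixMin-attained s (x ∷ xs) (suc t) with prefixMin-attained (s ⊓ x) xs t
... | inj₂ (suc j , j≤t , e) = inj₂ (suc (suc j) , s≤s j≤t , e)
... | inj₂ (zero  , _   , e) = contradiction (trans (sym (at-zero xs)) e) λ ()
... | inj₁ eq with ⊓-sel s x
...   | inj₁ s⊓x≡s = inj₁ (trans eq s⊓x≡s)
...   | inj₂ s⊓x≡x = inj₂ (1 , s≤s z≤n , cong just (sym (trans eq s⊓x≡x)))

prefixMin-suc : ∀ s xs t {b} → at xs (suc t) ≡ just b → prefixMin s xs (suc t) ≡ prefixMin s xs t ⊓ b
prefixMin-suc s (x ∷ [])     zero    refl = refl
prefixMin-suc s (x ∷ y ∷ xs) zero    refl = refl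
prefixMin-suc s (x ∷ xs)     (suc t) e    = prefixMin-suc (s ⊓ x) xs t e

<prefixMin⇒IsLMin : ∀ s xs i {a} → at xs (suc i) ≡ just a → a < prefixMin s xs i → IsLMin xs (suc i) a
<prefixMin⇒IsLMin s xs i e a< =
  e , λ j b j<1+i e′ → <-≤-trans a< (prefixMin-≤-at s xs e′ (≤-pred j<1+i))

IsLMin⇒<prefixMin : ∀ s xs i {a} → a < s → IsLMin xs (suc i) a → a < prefixMin s xs i
IsLMin⇒<prefixMin s xs i {a} a<s (_ , smaller) with prefixMin-attained s xs i
... | inj₁ eq              = subst (a <_) (sym eq) a<s
... | inj₂ (j , j≤i , e)   = smaller j _ (s≤s j≤i) e

module _ {n τ} (τ-line : OneLine n τ) where
  open OneLine τ-line

  ¬IsLMin⇒smaller-before : ∀ {w y} → at τ w ≡ just y → ¬ IsLMin τ w y →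
                           ∃[ j ] ∃[ b ] (j < w × at τ j ≡ just b × b < y)
  ¬IsLMin⇒smaller-before {w} {y} e ¬lmin with at-just⇒1≤ τ w e
  ... | s≤s {n = i} _ with prefixMin-attained (suc n) τ i
  ...   | inj₁ eq =
    contradiction (<prefixMin⇒IsLMin (suc n) τ i e (subst (y <_) (sym eq) (s≤s (proj₂ (bounded e))))) ¬lmin
  ...   | inj₂ (j , j≤i , e′) =
    j , _ , s≤s j≤i , e′ , ≤∧≢⇒< (≮⇒≥ (¬lmin ∘ <prefixMin⇒IsLMin (suc n) τ i e)) min≢y
    where
    min≢y : prefixMin (suc n) τ i ≢ y
    min≢y eq = <-irrefl (injective e′ (subst (λ v → at τ w ≡ just v) (sym eq) e)) (s≤s j≤i)

DecreasingOffLMin : List ℕ → Set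
DecreasingOffLMin τ = ∀ {w w′ y y′} → w < w′ → at τ w ≡ just y → at τ w′ ≡ just y′ →
                      ¬ IsLMin τ w y → ¬ IsLMin τ w′ y′ → y′ < y

Avoids123⇒DecreasingOffLMin : ∀ {n τ} → OneLine n τ → Avoids123 τ → DecreasingOffLMin τ
Avoids123⇒DecreasingOffLMin {τ = τ} τ-line avoids {w} {w′} {y} {y′} w<w′ e e′ ¬lmin _
  with ¬IsLMin⇒smaller-before τ-line e ¬lmin | <-cmp y′ y
... | _ | tri< y′<y _ _ = y′<y
... | _ | tri≈ _ refl _ = contradiction (OneLine.injective τ-line e e′) (<⇒≢ w<w′)
... | j , b , j<w , eb , b<y | tri> _ _ y<y′ =
  contradiction (b , y , y′ , at-<-<⇒⊆ τ j w w′ eb e e′ j<w w<w′ , b<y , y<y′) avoids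

module _ {n τ₁ τ₂} (perm₁ : OneLine n τ₁) (perm₂ : OneLine n τ₂)
         (lmin₁⇒lmin₂ : ∀ {w y} → IsLMin τ₁ w y → IsLMin τ₂ w y)
         (dec₁ : DecreasingOffLMin τ₁) where
  private
    module P₁ = OneLine perm₁
    module P₂ = OneLine perm₂

  -- If τ₁ shows the smaller entry y at w, the entry z of τ₂ occurs in τ₁ right of w and off LMIN τ₁.
  agree-before⇒¬< : ∀ {w y z} → (∀ {p} → p < w → at τ₁ p ≡ at τ₂ p) →
                    at τ₁ w ≡ just y → at τ₂ w ≡ just z → ¬ y < z
  agree-before⇒¬< {w} {y} {z} agree e₁ e₂ y<z
    with P₁.onto (proj₁ (P₂.bounded e₂)) (proj₂ (P₂.bounded e₂))
  ... | p , e₁p with <-cmp p w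
  ...   | tri< p<w _ _ = <-irrefl (P₂.injective (trans (sym (agree p<w)) e₁p) e₂) p<w
  ...   | tri≈ _ refl _ = <-irrefl (just-injective (trans (sym e₁) e₁p)) y<z
  ...   | tri> _ _ w<p = <-asym y<z (dec₁ w<p e₁ e₁p ¬lmin-y ¬lmin-z)
    where
    ¬lmin-y : ¬ IsLMin τ₁ w y
    ¬lmin-y lmin = <-irrefl (just-injective (trans (sym (proj₁ (lmin₁⇒lmin₂ lmin))) e₂)) y<z
    ¬lmin-z : ¬ IsLMin τ₁ p z
    ¬lmin-z lmin = <-irrefl (P₂.injective e₂ (proj₁ (lmin₁⇒lmin₂ lmin))) w<p

OneLine-LMin-unique : ∀ {n τ₁ τ₂} → OneLine n τ₁ → OneLine n τ₂ →
                      (∀ w y → IsLMin τ₁ w y ⇔ IsLMin τ₂ w y) →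
                      DecreasingOffLMin τ₁ → DecreasingOffLMin τ₂ → τ₁ ≡ τ₂
OneLine-LMin-unique {n} {τ₁} {τ₂} perm₁ perm₂ same dec₁ dec₂ = at-extensional τ₁ τ₂ (<-rec _ agree)
  where
  open OneLine
  agree : ∀ w → (∀ {p} → p < w → at τ₁ p ≡ at τ₂ p) → at τ₁ w ≡ at τ₂ w
  agree zero    _      = trans (at-zero τ₁) (sym (at-zero τ₂))
  agree (suc w) before with suc w ≤? n
  ... | no w≰n  = trans (undefined perm₁ (≰⇒> w≰n)) (sym (undefined perm₂ (≰⇒> w≰n)))
  ... | yes w≤n with defined perm₁ (s≤s z≤n) w≤n | defined perm₂ (s≤s z≤n) w≤n
  ...   | y , e₁ | z , e₂ with <-cmp y z
  ...     | tri≈ _ refl _ = trans e₁ (sym e₂)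
  ...     | tri< y<z _ _  =
    ⊥-elim (agree-before⇒¬< perm₁ perm₂ (Equivalence.to (same _ _)) dec₁ before e₁ e₂ y<z)
  ...     | tri> _ _ z<y  =
    ⊥-elim (agree-before⇒¬< perm₂ perm₁ (Equivalence.from (same _ _)) dec₂ (sym ∘ before) e₂ e₁ z<y)

LMin-bounds-redundant : ∀ {n π σ} → OneLine n π → OneLine n σ →
                        (∀ i a → 1 ≤ i → i ≤ n → 1 ≤ a → a ≤ n → (IsLMin π i a ⇔ IsLMin σ a i)) →
                        ∀ i a → IsLMin π i a ⇔ IsLMin σ a i
LMin-bounds-redundant {π = π} {σ} π-line σ-line transposed i a = mk⇔ π⇒σ σ⇒π
  where
  π⇒σ : IsLMin π i a → IsLMin σ a i
  π⇒σ lmin@(e , _) with (1≤i , i≤n) ← OneLine.positioned π-line e | (1≤a , a≤n) ← OneLine.bounded π-line e =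
    Equivalence.to (transposed i a 1≤i i≤n 1≤a a≤n) lmin
  σ⇒π : IsLMin σ a i → IsLMin π i a
  σ⇒π lmin@(e , _) with (1≤a , a≤n) ← OneLine.positioned σ-line e | (1≤i , i≤n) ← OneLine.bounded σ-line e =
    Equivalence.from (transposed i a 1≤i i≤n 1≤a a≤n) lmin

-- The Dyck path of a 132-avoiding word

maxL-≥ : ∀ w {y} → y ∈ w → y ≤ maxL w
maxL-≥ (x ∷ xs) (here refl) = m≤m⊔n x (maxL xs)
maxL-≥ (x ∷ xs) (there y∈) = ≤-trans (maxL-≥ xs y∈) (m≤n⊔m x (maxL xs))

maxL-∈ : ∀ x xs → maxL (x ∷ xs) ∈ x ∷ xs
maxL-∈ x []       = here (⊔-identityʳ x)
maxL-∈ x (y ∷ xs) with ⊔-sel x (maxL (y ∷ xs))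
... | inj₁ eq = here eq
... | inj₂ eq = there (subst (_∈ y ∷ xs) (sym eq) (maxL-∈ y xs))

breakAt-∈ : ∀ m w → m ∈ w → w ≡ proj₁ (breakAt m w) ++ m ∷ proj₂ (breakAt m w)
breakAt-∈ m (x ∷ xs) m∈ with x ≡ᵇ m in eq
... | true = cong (_∷ xs) (≡ᵇ⇒≡ x m (subst T (sym eq) _))
... | false with m∈
...   | here refl = contradiction (≡⇒≡ᵇ m m refl) (subst T eq)
...   | there m∈xs = cong (x ∷_) (breakAt-∈ m xs m∈xs)

runningMin : ℕ → List ℕ → List ℕ
runningMin c []       = []
runningMin c (x ∷ xs) = c ⊓ x ∷ runningMin (c ⊓ x) xs

runningMin-++ : ∀ c xs ys → runningMin c (xs ++ ys) ≡ runningMin c xs ++ runningMin (foldl _⊓_ c xs) ys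
runningMin-++ c []       ys = refl
runningMin-++ c (x ∷ xs) ys = cong (c ⊓ x ∷_) (runningMin-++ (c ⊓ x) xs ys)

runningMin-∈ : ∀ c xs {y} → y ∈ runningMin c xs → y ≡ c ⊎ y ∈ xs
runningMin-∈ c (x ∷ xs) (here refl) = map₂ here (⊓-sel c x)
runningMin-∈ c (x ∷ xs) (there y∈) with runningMin-∈ (c ⊓ x) xs y∈
... | inj₁ refl = map₂ here (⊓-sel c x)
... | inj₂ y∈xs = inj₂ (there y∈xs)

runningMin-∈-bounded : ∀ c xs {y} → (∀ {z} → z ∈ xs → z ≤ c) → y ∈ runningMin c xs → y ∈ xs
runningMin-∈-bounded c (x ∷ xs) ≤c y∈ rewrite m≥n⇒m⊓n≡n (≤c (here refl)) with y∈
... | here refl  = here refl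
... | there y∈′ with runningMin-∈ x xs y∈′
...   | inj₁ refl = here refl
...   | inj₂ y∈xs = there y∈xs

foldl-⊓-≤ : ∀ c xs → foldl _⊓_ c xs ≤ c
foldl-⊓-≤ c []       = ≤-refl
foldl-⊓-≤ c (x ∷ xs) = ≤-trans (foldl-⊓-≤ (c ⊓ x) xs) (m⊓n≤m c x)

foldl-⊓-≤-∈ : ∀ c xs {y} → y ∈ xs → foldl _⊓_ c xs ≤ y
foldl-⊓-≤-∈ c (x ∷ xs) (here refl) = ≤-trans (foldl-⊓-≤ (c ⊓ x) xs) (m⊓n≤n c x)
foldl-⊓-≤-∈ c (x ∷ xs) (there y∈)  = foldl-⊓-≤-∈ (c ⊓ x) xs y∈

foldl-⊓-sel : ∀ c xs → foldl _⊓_ c xs ≡ c ⊎ foldl _⊓_ c xs ∈ xs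
foldl-⊓-sel c []       = inj₁ refl
foldl-⊓-sel c (x ∷ xs) with foldl-⊓-sel (c ⊓ x) xs
... | inj₁ eq  = Sum.map (trans eq) (here ∘ trans eq) (⊓-sel c x)
... | inj₂ ∈xs = inj₂ (there ∈xs)

lastOr : ℕ → List ℕ → ℕ
lastOr p []       = p
lastOr p (x ∷ xs) = lastOr x xs

lastOr-runningMin : ∀ c xs → lastOr c (runningMin c xs) ≡ foldl _⊓_ c xs
lastOr-runningMin c []       = refl
lastOr-runningMin c (x ∷ xs) = lastOr-runningMin (c ⊓ x) xs

lastOr-map : ∀ (f : ℕ → ℕ) p xs → lastOr (f p) (map f xs) ≡ f (lastOr p xs)
lastOr-map f p []       = refl
lastOr-map f p (x ∷ xs) = lastOr-map f x xs

-- pathWithUps p (h₁ ∷ h₂ ∷ …) is the path whose i-th down-step is preceded by hᵢ up-steps in all,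
-- p of which have already been drawn.
pathWithUps : ℕ → List ℕ → List Step
pathWithUps p []       = []
pathWithUps p (h ∷ hs) = replicate (h ∸ p) u ++ d ∷ pathWithUps h hs

pathWithUps-++ : ∀ p hs hs′ →
                 pathWithUps p (hs ++ hs′) ≡ pathWithUps p hs ++ pathWithUps (lastOr p hs) hs′
pathWithUps-++ p []       hs′ = refl
pathWithUps-++ p (h ∷ hs) hs′ =
  trans (cong (λ rest → replicate (h ∸ p) u ++ d ∷ rest) (pathWithUps-++ h hs hs′))
        (sym (++-assoc (replicate (h ∸ p) u) (d ∷ pathWithUps h hs) (pathWithUps (lastOr h hs) hs′)))

pathWithUps-+ : ∀ k p hs → pathWithUps (k + p) (map (k +_) hs) ≡ pathWithUps p hs
pathWithUps-+ k p []       = refl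
pathWithUps-+ k p (h ∷ hs) =
  cong₂ (λ ups rest → replicate ups u ++ d ∷ rest) ([m+n]∸[m+o]≡n∸o k h p) (pathWithUps-+ k h hs)

pathWithUps-shift : ∀ k hs → pathWithUps k (map (k +_) hs) ≡ pathWithUps 0 hs
pathWithUps-shift k hs =
  subst (λ k′ → pathWithUps k′ (map (k +_) hs) ≡ pathWithUps 0 hs) (+-identityʳ k) (pathWithUps-+ k 0 hs)

pathWithUps-nest : ∀ hs a hs′ → lastOr 0 hs ≡ a →
  pathWithUps 0 (map suc hs ++ suc a ∷ map (suc a +_) hs′) ≡ u ∷ pathWithUps 0 hs ++ d ∷ pathWithUps 0 hs′
pathWithUps-nest []       .0 hs′ refl = cong (λ rest → u ∷ d ∷ rest) (pathWithUps-shift 1 hs′)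
pathWithUps-nest (h ∷ hs) a  hs′ last≡a = begin
  pathWithUps 0 (map suc (h ∷ hs) ++ suc a ∷ map (suc a +_) hs′)
    ≡⟨ pathWithUps-++ 0 (map suc (h ∷ hs)) _ ⟩
  u ∷ pathWithUps 1 (map suc (h ∷ hs)) ++
    pathWithUps (lastOr (suc h) (map suc hs)) (suc a ∷ map (suc a +_) hs′)
    ≡⟨ cong₂ (λ p q → u ∷ p ++ pathWithUps q (suc a ∷ map (suc a +_) hs′))
             (pathWithUps-shift 1 (h ∷ hs)) (trans (lastOr-map suc h hs) (cong suc last≡a)) ⟩
  u ∷ pathWithUps 0 (h ∷ hs) ++ replicate (suc a ∸ suc a) u ++ d ∷ pathWithUps (suc a) (map (suc a +_) hs′)
    ≡⟨ cong₂ (λ ups rest → u ∷ pathWithUps 0 (h ∷ hs) ++ replicate ups u ++ d ∷ rest)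
             (n∸n≡0 a) (pathWithUps-shift (suc a) hs′) ⟩
  u ∷ pathWithUps 0 (h ∷ hs) ++ d ∷ pathWithUps 0 hs′ ∎
  where open ≡-Reasoning

upCounts : ℕ → List ℕ → List ℕ
upCounts s w = map (λ m → count≥ m w) (runningMin s w)

lastOr-upCounts : ∀ s w → lastOr 0 (upCounts s w) ≡ length w
lastOr-upCounts s []      = refl
lastOr-upCounts s (x ∷ w) = begin
  lastOr 0 (upCounts s (x ∷ w))
    ≡⟨ lastOr-map (λ m → count≥ m (x ∷ w)) (s ⊓ x) (runningMin (s ⊓ x) w) ⟩
  count≥ (lastOr (s ⊓ x) (runningMin (s ⊓ x) w)) (x ∷ w)
    ≡⟨ cong (λ m → count≥ m (x ∷ w)) (lastOr-runningMin (s ⊓ x) w) ⟩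
  count≥ (foldl _⊓_ s (x ∷ w)) (x ∷ w)
    ≡⟨ count≥-all _ (x ∷ w) (foldl-⊓-≤-∈ s (x ∷ w)) ⟩
  length (x ∷ w) ∎
  where open ≡-Reasoning

module SplitAtMaximum {L M R s} (w! : Unique (L ++ M ∷ R)) (avoids : Avoids132 (L ++ M ∷ R))
                      (M-max : ∀ {z} → z ∈ L ++ M ∷ R → z ≤ M)
                      (≤s : ∀ {z} → z ∈ L ++ M ∷ R → z ≤ s) where

  L<M : ∀ {l} → l ∈ L → l < M
  L<M l∈ = ≤∧≢⇒< (M-max (∈-++⁺ˡ l∈)) (Unique⇒pair-≢ w! (++⁺ (from∈ l∈) (refl ∷ minimum R)))

  R<M : ∀ {r} → r ∈ R → r < M
  R<M r∈ = ≤∧≢⇒< (M-max (∈-++⁺ʳ L (there r∈)))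
                  (≢-sym (Unique⇒pair-≢ w! (++⁺ˡ L (refl ∷ from∈ r∈))))

  R<L : ∀ {l r} → l ∈ L → r ∈ R → r < l
  R<L {l} {r} l∈ r∈ with <-cmp r l
  ... | tri< r<l _ _ = r<l
  ... | tri≈ _ refl _ = contradiction refl (Unique⇒pair-≢ w! (++⁺ (from∈ l∈) (M ∷ʳ from∈ r∈)))
  ... | tri> _ _ l<r =
    contradiction (l , M , r , ++⁺ (from∈ l∈) (refl ∷ from∈ r∈) , l<r , R<M r∈) avoids

  c : ℕ
  c = foldl _⊓_ s L ⊓ M

  R<c : ∀ {r} → r ∈ R → r < c
  R<c {r} r∈ = ⊓-pres-m< r<min (R<M r∈)
    where
    r<min : r < foldl _⊓_ s L
    r<min with foldl-⊓-sel s L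
    ... | inj₁ eq  = subst (r <_) (sym eq) (<-≤-trans (R<M r∈) (≤s (∈-++⁺ʳ L (here refl))))
    ... | inj₂ ∈L  = R<L ∈L r∈

  count≥-L : ∀ {y} → y ∈ L → count≥ y (L ++ M ∷ R) ≡ suc (count≥ y L)
  count≥-L {y} y∈ = begin
    count≥ y (L ++ M ∷ R)            ≡⟨ count≥-++ y L (M ∷ R) ⟩
    count≥ y L + count≥ y (M ∷ R)    ≡⟨ cong (count≥ y L +_) (count≥-∷-≤ R (<⇒≤ (L<M y∈))) ⟩
    count≥ y L + suc (count≥ y R)    ≡⟨ cong (λ k → count≥ y L + suc k)
                                             (count≥-none y R (R<L y∈)) ⟩
    count≥ y L + 1                   ≡⟨ +-comm (count≥ y L) 1 ⟩
    suc (count≥ y L)                 ∎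
    where open ≡-Reasoning

  count≥-c : count≥ c (L ++ M ∷ R) ≡ suc (length L)
  count≥-c = begin
    count≥ c (L ++ M ∷ R)           ≡⟨ count≥-++ c L (M ∷ R) ⟩
    count≥ c L + count≥ c (M ∷ R)   ≡⟨ cong₂ _+_
                                        (count≥-all c L (λ l∈ → ≤-trans (m⊓n≤m _ M) (foldl-⊓-≤-∈ s L l∈)))
                                        (count≥-∷-≤ R (m⊓n≤n _ M)) ⟩
    length L + suc (count≥ c R)     ≡⟨ cong (λ k → length L + suc k) (count≥-none c R R<c) ⟩
    length L + 1                    ≡⟨ +-comm (length L) 1 ⟩
    suc (length L)                  ∎
    where open ≡-Reasoning

  count≥-R : ∀ {y} → y ∈ R → count≥ y (L ++ M ∷ R) ≡ suc (length L) + count≥ y R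
  count≥-R {y} y∈ = begin
    count≥ y (L ++ M ∷ R)            ≡⟨ count≥-++ y L (M ∷ R) ⟩
    count≥ y L + count≥ y (M ∷ R)    ≡⟨ cong₂ _+_ (count≥-all y L (λ l∈ → <⇒≤ (R<L l∈ y∈)))
                                                  (count≥-∷-≤ R (<⇒≤ (R<M y∈))) ⟩
    length L + suc (count≥ y R)      ≡⟨ +-suc (length L) (count≥ y R) ⟩
    suc (length L) + count≥ y R      ∎
    where open ≡-Reasoning

  upCounts-split : upCounts s (L ++ M ∷ R) ≡
                   map suc (upCounts s L) ++ suc (length L) ∷ map (suc (length L) +_) (upCounts c R)
  upCounts-split = begin
    map count-in-w (runningMin s (L ++ M ∷ R))
      ≡⟨ cong (map count-in-w) (runningMin-++ s L (M ∷ R)) ⟩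
    map count-in-w (runningMin s L ++ c ∷ runningMin c R)
      ≡⟨ map-++ count-in-w (runningMin s L) (c ∷ runningMin c R) ⟩
    map count-in-w (runningMin s L) ++ count-in-w c ∷ map count-in-w (runningMin c R)
      ≡⟨ cong₂ _++_ on-L (cong₂ _∷_ count≥-c on-R) ⟩
    map suc (upCounts s L) ++ suc (length L) ∷ map (suc (length L) +_) (upCounts c R) ∎
    where
    open ≡-Reasoning
    count-in-w : ℕ → ℕ
    count-in-w m = count≥ m (L ++ M ∷ R)
    on-L : map count-in-w (runningMin s L) ≡ map suc (upCounts s L)
    on-L = trans (map-cong-local (All.tabulate (count≥-L ∘ runningMin-∈-bounded s L (≤s ∘ ∈-++⁺ˡ))))
                 (map-∘ (runningMin s L))
    on-R : map count-in-w (runningMin c R) ≡ map (suc (length L) +_) (upCounts c R)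
    on-R = trans (map-cong-local (All.tabulate (count≥-R ∘ runningMin-∈-bounded c R (<⇒≤ ∘ R<c))))
                 (map-∘ (runningMin c R))

fAux≡pathWithUps : ∀ k w s → length w ≤ k → Unique w → Avoids132 w → (∀ {z} → z ∈ w → z ≤ s) →
                fAux k w ≡ pathWithUps 0 (upCounts s w)
fAux≡pathWithUps zero    []       s _ _ _ _ = refl
fAux≡pathWithUps (suc k) []       s _ _ _ _ = refl
fAux≡pathWithUps (suc k) (x ∷ xs) s len≤ w! avoids ≤s = begin
  u ∷ fAux k L ++ d ∷ fAux k R
    ≡⟨ cong₂ (λ p q → u ∷ p ++ d ∷ q)
             (fAux≡pathWithUps k L s len-L (Unique-resp-⊇ L⊆ w!′) (Avoids132-resp-⊇ L⊆ avoids′)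
                            (≤s′ ∘ ∈-++⁺ˡ))
             (fAux≡pathWithUps k R S.c len-R (Unique-resp-⊇ R⊆ w!′) (Avoids132-resp-⊇ R⊆ avoids′)
                            (<⇒≤ ∘ S.R<c)) ⟩
  u ∷ pathWithUps 0 (upCounts s L) ++ d ∷ pathWithUps 0 (upCounts S.c R)
    ≡⟨ sym (pathWithUps-nest (upCounts s L) (length L) (upCounts S.c R) (lastOr-upCounts s L)) ⟩
  pathWithUps 0 (map suc (upCounts s L) ++ suc (length L) ∷ map (suc (length L) +_) (upCounts S.c R))
    ≡⟨ cong (pathWithUps 0) (sym S.upCounts-split) ⟩
  pathWithUps 0 (upCounts s (L ++ M ∷ R))
    ≡⟨ cong (pathWithUps 0 ∘ upCounts s) (sym w≡) ⟩
  pathWithUps 0 (upCounts s (x ∷ xs)) ∎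
  where
  open ≡-Reasoning
  M : ℕ
  M = maxL (x ∷ xs)
  L R : List ℕ
  L = proj₁ (breakAt M (x ∷ xs))
  R = proj₂ (breakAt M (x ∷ xs))
  w≡ : x ∷ xs ≡ L ++ M ∷ R
  w≡ = breakAt-∈ M (x ∷ xs) (maxL-∈ x xs)
  w!′ : Unique (L ++ M ∷ R)
  w!′ = subst Unique w≡ w!
  avoids′ : Avoids132 (L ++ M ∷ R)
  avoids′ = subst Avoids132 w≡ avoids
  ≤s′ : ∀ {z} → z ∈ L ++ M ∷ R → z ≤ s
  ≤s′ = ≤s ∘ subst (_ ∈_) (sym w≡)
  module S = SplitAtMaximum w!′ avoids′ (maxL-≥ (x ∷ xs) ∘ subst (_ ∈_) (sym w≡)) ≤s′
  L⊆ : L ⊆ L ++ M ∷ R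
  L⊆ = ++⁺ʳ (M ∷ R) ⊆-refl
  R⊆ : R ⊆ L ++ M ∷ R
  R⊆ = ++⁺ˡ L (M ∷ʳ ⊆-refl)
  len-LR : length L + length R ≤ k
  len-LR = ≤-pred (subst (_≤ suc k) (trans (cong length w≡) (trans (length-++ L) (+-suc (length L) (length R))))
                         len≤)
  len-L : length L ≤ k
  len-L = ≤-trans (m≤m+n (length L) (length R)) len-LR
  len-R : length R ≤ k
  len-R = ≤-trans (m≤n+m (length R) (length L)) len-LR

-- Richards' map

cell : List (Maybe ℕ) → ℕ → Maybe ℕ
cell []       _             = nothing
cell (x ∷ xs) zero          = nothing
cell (x ∷ xs) (suc zero)    = x
cell (x ∷ xs) (suc (suc i)) = cell xs (suc i)

filledCount : List (Maybe ℕ) → ℕ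
filledCount []             = 0
filledCount (nothing ∷ xs) = filledCount xs
filledCount (just _ ∷ xs)  = suc (filledCount xs)

cell-replicate : ∀ k w → cell (replicate k nothing) w ≡ nothing
cell-replicate zero    w             = refl
cell-replicate (suc k) zero          = refl
cell-replicate (suc k) (suc zero)    = refl
cell-replicate (suc k) (suc (suc w)) = cell-replicate k (suc w)

filledCount-replicate : ∀ k → filledCount (replicate k nothing) ≡ 0
filledCount-replicate zero    = refl
filledCount-replicate (suc k) = filledCount-replicate k

filledCount-≤ : ∀ arr → filledCount arr ≤ length arr
filledCount-≤ []             = z≤n
filledCount-≤ (nothing ∷ xs) = m≤n⇒m≤1+n (filledCount-≤ xs)
filledCount-≤ (just _ ∷ xs)  = s≤s (filledCount-≤ xs)

filledCount-∷ : ∀ x arr → filledCount arr ≤ filledCount (x ∷ arr)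
filledCount-∷ nothing  arr = ≤-refl
filledCount-∷ (just _) arr = n≤1+n _

filledCount-full : ∀ arr w → filledCount arr ≡ length arr → 1 ≤ w → w ≤ length arr →
                   cell arr w ≢ nothing
filledCount-full []              (suc w)       _    _ ()
filledCount-full (nothing ∷ arr) w             full _ _ = contradiction full (<⇒≢ (s≤s (filledCount-≤ arr)))
filledCount-full (just x ∷ arr)  (suc zero)    full _ _ = λ ()
filledCount-full (just x ∷ arr)  (suc (suc w)) full _ (s≤s w≤) =
  filledCount-full arr (suc w) (suc-injective full) (s≤s z≤n) w≤

setAt-length : ∀ arr k v → length (setAt arr k v) ≡ length arr
setAt-length []        k             v = refl
setAt-length (x ∷ arr) zero          v = refl
setAt-length (x ∷ arr) (suc zero)    v = refl
setAt-length (x ∷ arr) (suc (suc k)) v = cong suc (setAt-length arr (suc k) v)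

cell-setAt-≡ : ∀ arr k v → 1 ≤ k → k ≤ length arr → cell (setAt arr k v) k ≡ just v
cell-setAt-≡ (x ∷ arr) (suc zero)    v _ _        = refl
cell-setAt-≡ (x ∷ arr) (suc (suc k)) v _ (s≤s k≤) = cell-setAt-≡ arr (suc k) v (s≤s z≤n) k≤

cell-setAt-≢ : ∀ arr k v w → w ≢ k → cell (setAt arr k v) w ≡ cell arr w
cell-setAt-≢ []        k             v w             _   = refl
cell-setAt-≢ (x ∷ arr) zero          v w             _   = refl
cell-setAt-≢ (x ∷ arr) (suc zero)    v zero          _   = refl
cell-setAt-≢ (x ∷ arr) (suc zero)    v (suc zero)    w≢k = contradiction refl w≢k
cell-setAt-≢ (x ∷ arr) (suc zero)    v (suc (suc w)) _   = refl
cell-setAt-≢ (x ∷ arr) (suc (suc k)) v zero          _   = refl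
cell-setAt-≢ (x ∷ arr) (suc (suc k)) v (suc zero)    _   = refl
cell-setAt-≢ (x ∷ arr) (suc (suc k)) v (suc (suc w)) w≢k =
  cell-setAt-≢ arr (suc k) v (suc w) (w≢k ∘ cong suc)

filledCount-setAt : ∀ arr k v → 1 ≤ k → k ≤ length arr → cell arr k ≡ nothing →
                    filledCount (setAt arr k v) ≡ suc (filledCount arr)
filledCount-setAt (nothing ∷ arr) (suc zero)    v _ _        _ = refl
filledCount-setAt (nothing ∷ arr) (suc (suc k)) v _ (s≤s k≤) e =
  filledCount-setAt arr (suc k) v (s≤s z≤n) k≤ e
filledCount-setAt (just x ∷ arr)  (suc (suc k)) v _ (s≤s k≤) e =
  cong suc (filledCount-setAt arr (suc k) v (s≤s z≤n) k≤ e)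

cell-just⇒at : ∀ arr w {y} → cell arr w ≡ just y → at (map (fromMaybe 0) arr) w ≡ just y
cell-just⇒at (x ∷ arr) (suc zero)    refl = refl
cell-just⇒at (x ∷ arr) (suc (suc w)) e    = cell-just⇒at arr (suc w) e

some-empty-cell : ∀ arr → filledCount arr < length arr →
                  ∃[ w ] (1 ≤ w × w ≤ length arr × cell arr w ≡ nothing)
some-empty-cell (nothing ∷ arr) _ = 1 , s≤s z≤n , s≤s z≤n , refl
some-empty-cell (just x ∷ arr) (s≤s count<) with some-empty-cell arr count<
... | suc w , _ , w≤ , e = suc (suc w) , s≤s z≤n , s≤s w≤ , e

-- Of the length arr ∸ c cells right of the filled cell c, at most filledCount arr ∸ 1 are filled.
empty-cell-after : ∀ arr c → 1 ≤ c → cell arr c ≢ nothing → filledCount arr + c ≤ length arr →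
                   ∃[ w ] (c < w × w ≤ length arr × cell arr w ≡ nothing)
empty-cell-after (nothing ∷ arr) (suc zero) _ filled _ = contradiction refl filled
empty-cell-after (just x ∷ arr) (suc zero) _ _ (s≤s room)
  with some-empty-cell arr (subst (_≤ length arr) (+-comm (filledCount arr) 1) room)
... | suc w , _ , w≤ , e = suc (suc w) , s≤s (s≤s z≤n) , s≤s w≤ , e
empty-cell-after (x ∷ arr) (suc (suc c)) _ filled room
  with empty-cell-after arr (suc c) (s≤s z≤n) filled room′
  where
  room′ : filledCount arr + suc c ≤ length arr
  room′ = ≤-pred (begin
    suc (filledCount arr + suc c)   ≡⟨ sym (+-suc (filledCount arr) (suc c)) ⟩
    filledCount arr + suc (suc c)   ≤⟨ +-monoˡ-≤ (suc (suc c)) (filledCount-∷ x arr) ⟩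
    filledCount (x ∷ arr) + suc (suc c) ≤⟨ room ⟩
    suc (length arr)                ∎)
    where open ≤-Reasoning
... | suc w , c<w , w≤ , e = suc (suc w) , s≤s c<w , s≤s w≤ , e

lastNothing-≥ : ∀ arr w → 1 ≤ w → w ≤ length arr → cell arr w ≡ nothing →
                ∃[ k ] (lastNothing arr ≡ just k × w ≤ k)
lastNothing-≥ (just x ∷ arr)  (suc zero) _ _ ()
lastNothing-≥ (nothing ∷ arr) (suc zero) _ _ refl with lastNothing arr
... | just k  = suc k , refl , s≤s z≤n
... | nothing = 1 , refl , ≤-refl
lastNothing-≥ (x ∷ arr) (suc (suc w)) _ (s≤s w≤) empty
  with lastNothing-≥ arr (suc w) (s≤s z≤n) w≤ empty
... | k , e , w≤k rewrite e = suc k , refl , s≤s w≤k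

lastNothing-beyond : ∀ arr c → 1 ≤ c → cell arr c ≢ nothing → filledCount arr + c ≤ length arr →
                     ∃[ k ] (lastNothing arr ≡ just k × c < k)
lastNothing-beyond arr c 1≤c filled room with empty-cell-after arr c 1≤c filled room
... | w , c<w , w≤ , empty with lastNothing-≥ arr w (≤-trans 1≤c (<⇒≤ c<w)) w≤ empty
...   | k , last≡k , w≤k = k , last≡k , <-≤-trans c<w w≤k

lastNothing-just : ∀ arr k → lastNothing arr ≡ just k →
                   1 ≤ k × k ≤ length arr × cell arr k ≡ nothing ×
                   (∀ w → k < w → w ≤ length arr → cell arr w ≢ nothing)
lastNothing-just (x ∷ arr) k e with lastNothing arr in eq
lastNothing-just (x ∷ arr) .(suc k) refl | just k with lastNothing-just arr k eq
... | s≤s _ , k≤ , empty , after = s≤s z≤n , s≤s k≤ , empty , after′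
  where
  after′ : ∀ w → suc k < w → w ≤ suc (length arr) → cell (x ∷ arr) w ≢ nothing
  after′ (suc (suc w)) (s≤s k<w) (s≤s w≤) = after (suc w) k<w w≤
lastNothing-just (nothing ∷ arr) .1 refl | nothing = s≤s z≤n , s≤s z≤n , refl , after
  where
  after : ∀ w → 1 < w → w ≤ suc (length arr) → cell (nothing ∷ arr) w ≢ nothing
  after (suc zero)    (s≤s ()) _
  after (suc (suc w)) _ (s≤s w≤) empty with lastNothing-≥ arr (suc w) (s≤s z≤n) w≤ empty
  ... | k , e′ , _ = contradiction (trans (sym eq) e′) λ ()
lastNothing-just (just x ∷ arr) k () | nothing

module _ (n : ℕ) where

  riAux-ups : ∀ k prev j i p arr →
              riAux n prev j i (replicate (suc k) u ++ p) arr ≡ riAux n true (suc k + j) i p arr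
  riAux-ups zero    prev j i p arr = refl
  riAux-ups (suc k) prev j i p arr =
    trans (riAux-ups k true (suc j) i p arr) (cong (λ j′ → riAux n true j′ i p arr) (+-suc (suc k) j))

  riAux-peak : ∀ {j j′} i p arr → j < j′ →
               riAux n false j i (replicate (j′ ∸ j) u ++ d ∷ p) arr ≡
               riAux n false j′ (suc i) p (setAt arr (suc n ∸ j′) (suc i))
  riAux-peak {j} {j′} i p arr j<j′ with j′ ∸ j in eq
  ... | zero  = contradiction eq (m>n⇒m∸n≢0 j<j′)
  ... | suc k = trans (riAux-ups k false j i (d ∷ p) arr)
                      (cong (λ j″ → riAux n false j″ (suc i) p (setAt arr (suc n ∸ j″) (suc i))) 1+k+j≡j′)
    where
    1+k+j≡j′ : suc k + j ≡ j′
    1+k+j≡j′ = trans (cong (_+ j) (sym eq)) (m∸n+n≡m (<⇒≤ j<j′))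

  riAux-flat : ∀ j i p arr →
               riAux n false j i (replicate (j ∸ j) u ++ d ∷ p) arr ≡ riAux n false j (suc i) p (setLast arr (suc i))
  riAux-flat j i p arr rewrite n∸n≡0 j = refl

-- Richards' map on the Dyck path of a 132-avoiding permutation

module Richards {n π} (perm : IsPerm n π) where

  private
    module Π = OneLine (IsPerm⇒OneLine perm)

  m : ℕ → ℕ
  m = prefixMin (suc n) π

  -- Peak t: the t-th down-step of f π follows an up-step; equivalently (t , m t) ∈ LMIN π.
  Peak Fill : ℕ → Set
  Peak y = m y < m (pred y)
  Fill y = m y ≡ m (pred y)

  Placement : ℕ → ℕ → Set
  Placement y w = (Peak y × w ≡ m y) ⊎ (Fill y × m y < w)

  Peak⇒¬Fill : ∀ {y} → Peak y → ¬ Fill y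
  Peak⇒¬Fill peak fill = <-irrefl fill peak

  m≤1+n : ∀ t → m t ≤ suc n
  m≤1+n = prefixMin-≤ (suc n) π

  m-antitone : ∀ {t t′} → t ≤ t′ → m t′ ≤ m t
  m-antitone = prefixMin-antitone (suc n) π

  m-≤-pred : ∀ t → m t ≤ m (pred t)
  m-≤-pred zero    = ≤-refl
  m-≤-pred (suc t) = m-antitone (n≤1+n t)

  m-positive : ∀ t → 1 ≤ m t
  m-positive t with prefixMin-attained (suc n) π t
  ... | inj₁ eq          = subst (1 ≤_) (sym eq) (s≤s z≤n)
  ... | inj₂ (_ , _ , e) = proj₁ (Π.bounded e)

  Peak⊎Fill : ∀ y → Peak y ⊎ Fill y
  Peak⊎Fill y with m y <? m (pred y)
  ... | yes peak = inj₁ peak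
  ... | no ¬peak = inj₂ (≤-antisym (m-≤-pred y) (≮⇒≥ ¬peak))

  m-suc : ∀ t {x} → at π (suc t) ≡ just x → m (suc t) ≡ m t ⊓ x
  m-suc = prefixMin-suc (suc n) π

  Peak-1 : 1 ≤ n → Peak 1
  Peak-1 1≤n with Π.defined ≤-refl 1≤n
  ... | b , e = begin-strict
    m 1             ≡⟨ m-suc 0 e ⟩
    m 0 ⊓ b         ≤⟨ m⊓n≤n (m 0) b ⟩
    b               <⟨ s≤s (proj₂ (Π.bounded e)) ⟩
    suc n           ≡⟨ sym (prefixMin-zero (suc n) π) ⟩
    m 0             ∎
    where open ≤-Reasoning

  last-Peak : ∀ t → 1 ≤ t → t ≤ n → ∃[ y ] (1 ≤ y × y ≤ t × m y ≡ m t × Peak y)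
  last-Peak (suc zero)    _ 1≤n = 1 , ≤-refl , ≤-refl , refl , Peak-1 1≤n
  last-Peak (suc (suc t)) _ t≤n
    with Peak⊎Fill (suc (suc t)) | last-Peak (suc t) (s≤s z≤n) (≤-trans (n≤1+n _) t≤n)
  ... | inj₁ peak | _ = suc (suc t) , s≤s z≤n , ≤-refl , refl , peak
  ... | inj₂ fill | y , 1≤y , y≤t , my≡ , peak =
    y , 1≤y , ≤-trans y≤t (n≤1+n _) , trans my≡ (sym fill) , peak

  IsLMin⇒Peak : ∀ {i a} → IsLMin π i a → Peak i × m i ≡ a
  IsLMin⇒Peak {i} {a} lmin@(e , _) with at-just⇒1≤ π i e
  ... | s≤s {n = i′} _ = subst (_< m i′) (sym m-i≡a) a<m , m-i≡a
    where
    a<m : a < m i′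
    a<m = IsLMin⇒<prefixMin (suc n) π i′ (s≤s (proj₂ (Π.bounded e))) lmin
    m-i≡a : m (suc i′) ≡ a
    m-i≡a = trans (m-suc i′ e) (m≥n⇒m⊓n≡n (<⇒≤ a<m))

  Peak⇒IsLMin : ∀ {i} → 1 ≤ i → i ≤ n → Peak i → IsLMin π i (m i)
  Peak⇒IsLMin {suc i} _ i≤n peak with Π.defined (s≤s z≤n) i≤n
  ... | b , e with ⊓-sel (m i) b
  ...   | inj₁ m⊓b≡m = contradiction (trans (m-suc i e) m⊓b≡m) (<⇒≢ peak)
  ...   | inj₂ m⊓b≡b = subst (IsLMin π (suc i)) (sym m≡b)
                         (<prefixMin⇒IsLMin (suc n) π i e (subst (_< m i) m≡b peak))
    where
    m≡b : m (suc i) ≡ b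
    m≡b = trans (m-suc i e) m⊓b≡b

  prefix-fits-above-min : ∀ t → suc t ≤ n → suc t ≤ suc n ∸ m (suc t)
  prefix-fits-above-min t t<n = begin
    suc t                                ≡⟨ sym (trans (length-take (suc t) π)
                                                       (m≤n⇒m⊓n≡m (subst (suc t ≤_) (sym Π.length≡) t<n))) ⟩
    length (take (suc t) π)              ≡⟨ sym (count≥-all (m (suc t)) (take (suc t) π) above-min) ⟩
    count≥ (m (suc t)) (take (suc t) π)  ≤⟨ count≥-take (m (suc t)) (suc t) π ⟩
    count≥ (m (suc t)) π                 ≡⟨ IsPerm⇒count≥ perm (m (suc t)) (m-positive (suc t)) ⟩
    suc n ∸ m (suc t)                    ∎
    where
    open ≤-Reasoning
    above-min : ∀ {z} → z ∈ take (suc t) π → m (suc t) ≤ z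
    above-min z∈ with ∈-take⇒at π (suc t) z∈
    ... | j , j≤ , e = prefixMin-≤-at (suc n) π e j≤

  record Invariant (t : ℕ) (arr : List (Maybe ℕ)) : Set where
    field
      length≡         : length arr ≡ n
      filled          : ∀ {w y} → cell arr w ≡ just y → (1 ≤ y × y ≤ t) × (1 ≤ w × w ≤ n) × Placement y w
      complete        : ∀ {y} → 1 ≤ y → y ≤ t → ∃[ w ] cell arr w ≡ just y
      fills-decrease  : ∀ {w w′ y y′} → cell arr w ≡ just y → cell arr w′ ≡ just y′ →
                        Fill y → Fill y′ → y < y′ → w′ < w
      full-after-fill : ∀ {w y w′} → cell arr w ≡ just y → Fill y → w < w′ → w′ ≤ n → cell arr w′ ≢ nothing
      filledCount≡    : filledCount arr ≡ t
      injective       : ∀ {w w′ y} → cell arr w ≡ just y → cell arr w′ ≡ just y → w ≡ w′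

  initial : Invariant 0 (replicate n nothing)
  initial = record
    { length≡         = length-replicate n
    ; filled          = λ {w} → never {w}
    ; complete        = λ 1≤y y≤0 → contradiction (≤-trans 1≤y y≤0) λ ()
    ; fills-decrease  = λ {w} e → never {w} e
    ; full-after-fill = λ {w} e → never {w} e
    ; filledCount≡    = filledCount-replicate n
    ; injective       = λ {w} e → never {w} e
    }
    where
    never : ∀ {w y} {A : Set} → cell (replicate n nothing) w ≡ just y → A
    never {w} e with () ← trans (sym (cell-replicate n w)) e

  module Insert {t arr} (inv : Invariant t arr) {a} (empty : cell arr a ≡ nothing) (1≤a : 1 ≤ a) (a≤n : a ≤ n)
                (placement : Placement (suc t) a)
                (full-after : Fill (suc t) → ∀ {w} → a < w → w ≤ n → cell arr w ≢ nothing) where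
    open Invariant inv

    arr′ : List (Maybe ℕ)
    arr′ = setAt arr a (suc t)

    new-cell : cell arr′ a ≡ just (suc t)
    new-cell = cell-setAt-≡ arr a (suc t) 1≤a (subst (a ≤_) (sym length≡) a≤n)

    filled⇒≢a : ∀ {w y} → cell arr w ≡ just y → w ≢ a
    filled⇒≢a e refl with () ← trans (sym empty) e

    cell′ : ∀ {w y} → cell arr′ w ≡ just y → (w ≡ a × y ≡ suc t) ⊎ (w ≢ a × cell arr w ≡ just y)
    cell′ {w} e with w ≟ a
    ... | yes refl = inj₁ (refl , just-injective (trans (sym e) new-cell))
    ... | no  w≢a  = inj₂ (w≢a , trans (sym (cell-setAt-≢ arr a (suc t) w w≢a)) e)

    stays-filled : ∀ {w} → cell arr w ≢ nothing → cell arr′ w ≢ nothing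
    stays-filled {w} filled-w with w ≟ a
    ... | yes refl = λ e → contradiction (trans (sym new-cell) e) λ ()
    ... | no  w≢a  = filled-w ∘ trans (sym (cell-setAt-≢ arr a (suc t) w w≢a))

    old-≤ : ∀ {w y} → cell arr w ≡ just y → y ≤ t
    old-≤ e = proj₂ (proj₁ (filled e))

    invariant : Invariant (suc t) arr′
    invariant = record
      { length≡         = trans (setAt-length arr a (suc t)) length≡
      ; filled          = filled′
      ; complete        = complete′
      ; fills-decrease  = fills-decrease′
      ; full-after-fill = full-after-fill′
      ; filledCount≡    = trans (filledCount-setAt arr a (suc t) 1≤a (subst (a ≤_) (sym length≡) a≤n) empty)
                                (cong suc filledCount≡)
      ; injective       = injective′
      }
      where
      filled′ : ∀ {w y} → cell arr′ w ≡ just y → (1 ≤ y × y ≤ suc t) × (1 ≤ w × w ≤ n) × Placement y w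
      filled′ e with cell′ e
      ... | inj₁ (refl , refl) = (s≤s z≤n , ≤-refl) , (1≤a , a≤n) , placement
      ... | inj₂ (_ , e′) with filled e′
      ...   | (1≤y , y≤t) , rest = (1≤y , m≤n⇒m≤1+n y≤t) , rest

      complete′ : ∀ {y} → 1 ≤ y → y ≤ suc t → ∃[ w ] cell arr′ w ≡ just y
      complete′ 1≤y y≤ with m≤n⇒m<n∨m≡n y≤
      ... | inj₂ refl = a , new-cell
      ... | inj₁ y<   with complete 1≤y (≤-pred y<)
      ...   | w , e = w , trans (cell-setAt-≢ arr a (suc t) w (filled⇒≢a e)) e

      fills-decrease′ : ∀ {w w′ y y′} → cell arr′ w ≡ just y → cell arr′ w′ ≡ just y′ →
                        Fill y → Fill y′ → y < y′ → w′ < w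
      fills-decrease′ e₁ e₂ f₁ f₂ y<y′ with cell′ e₁ | cell′ e₂
      ... | inj₁ (refl , refl) | inj₁ (refl , refl) = contradiction y<y′ (<-irrefl refl)
      ... | inj₁ (refl , refl) | inj₂ (_ , e₂′)     =
        contradiction (≤-trans y<y′ (m≤n⇒m≤1+n (old-≤ e₂′))) (<-irrefl refl)
      ... | inj₂ (w≢a , e₁′)   | inj₁ (refl , refl) with <-cmp a _
      ...   | tri< a<w _ _  = a<w
      ...   | tri≈ _ a≡w _  = contradiction (sym a≡w) w≢a
      ...   | tri> _ _ w<a  = contradiction empty (full-after-fill e₁′ f₁ w<a a≤n)
      fills-decrease′ e₁ e₂ f₁ f₂ y<y′ | inj₂ (_ , e₁′) | inj₂ (_ , e₂′) = fills-decrease e₁′ e₂′ f₁ f₂ y<y′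

      full-after-fill′ : ∀ {w y w′} → cell arr′ w ≡ just y → Fill y → w < w′ → w′ ≤ n → cell arr′ w′ ≢ nothing
      full-after-fill′ e fill w<w′ w′≤n with cell′ e
      ... | inj₁ (refl , refl) = stays-filled (full-after fill w<w′ w′≤n)
      ... | inj₂ (_ , e′)      = stays-filled (full-after-fill e′ fill w<w′ w′≤n)

      injective′ : ∀ {w w′ y} → cell arr′ w ≡ just y → cell arr′ w′ ≡ just y → w ≡ w′
      injective′ e₁ e₂ with cell′ e₁ | cell′ e₂
      ... | inj₁ (w≡a , _)     | inj₁ (w′≡a , _)    = trans w≡a (sym w′≡a)
      ... | inj₁ (_ , refl)    | inj₂ (_ , e₂′)     = contradiction (old-≤ e₂′) (<-irrefl refl ∘ s≤s)
      ... | inj₂ (_ , e₁′)     | inj₁ (_ , refl)    = contradiction (old-≤ e₁′) (<-irrefl refl ∘ s≤s)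
      ... | inj₂ (_ , e₁′)     | inj₂ (_ , e₂′)     = injective e₁′ e₂′

  peak-step : ∀ {t arr} → Invariant t arr → Peak (suc t) → Invariant (suc t) (setAt arr (m (suc t)) (suc t))
  peak-step {t} {arr} inv peak =
    Insert.invariant inv empty (m-positive (suc t)) (≤-pred (<-≤-trans peak (m≤1+n t))) (inj₁ (peak , refl))
                     (⊥-elim ∘ Peak⇒¬Fill peak)
    where
    open Invariant inv
    empty : cell arr (m (suc t)) ≡ nothing
    empty with cell arr (m (suc t)) in e
    ... | nothing = refl
    ... | just y with filled e
    ...   | (_ , y≤t) , _ , inj₁ (_ , w≡my) =
      contradiction (≤-trans (m-antitone y≤t) (≤-reflexive (sym w≡my))) (<⇒≱ peak)
    ...   | (_ , y≤t) , _ , inj₂ (_ , my<w) =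
      contradiction (≤-<-trans (m-antitone y≤t) my<w) (<-asym peak)

  min-cell-filled : ∀ {t arr} → 1 ≤ t → t ≤ n → Invariant t arr → cell arr (m t) ≢ nothing
  min-cell-filled {t} {arr} 1≤t t≤n inv empty with last-Peak t 1≤t t≤n
  ... | y , 1≤y , y≤t , my≡mt , peak with Invariant.complete inv 1≤y y≤t
  ...   | w , e with Invariant.filled inv e
  ...     | _ , _ , inj₂ (fill , _) = contradiction fill (Peak⇒¬Fill peak)
  ...     | _ , _ , inj₁ (_ , w≡my)
    with () ← trans (sym empty) (subst (λ v → cell arr v ≡ just y) (trans w≡my my≡mt) e)

  room-right-of-min : ∀ {t arr} → suc t ≤ n → Invariant t arr → Fill (suc t) →
                      filledCount arr + m t ≤ length arr
  room-right-of-min {t} t<n inv fill =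
    subst₂ (λ k ℓ → k + m t ≤ ℓ) (sym filledCount≡) (sym length≡) (≤-pred (begin
      suc t + m t               ≤⟨ +-monoˡ-≤ (m t) (prefix-fits-above-min t t<n) ⟩
      suc n ∸ m (suc t) + m t   ≡⟨ cong (λ v → suc n ∸ v + m t) fill ⟩
      suc n ∸ m t + m t         ≡⟨ m∸n+n≡m (m≤1+n t) ⟩
      suc n                     ∎))
    where
    open Invariant inv
    open ≤-Reasoning

  fill-step : ∀ {t arr} → suc t ≤ n → Invariant t arr → Fill (suc t) → Invariant (suc t) (setLast arr (suc t))
  fill-step {zero} t<n _ fill = contradiction fill (Peak⇒¬Fill (Peak-1 t<n))
  fill-step {t@(suc _)} {arr} t<n inv fill
    with lastNothing-beyond arr (m t) (m-positive t) (min-cell-filled (s≤s z≤n) (<⇒≤ t<n) inv)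
                            (room-right-of-min t<n inv fill)
  ... | k , last≡k , mt<k with lastNothing-just arr k last≡k
  ...   | 1≤k , k≤ , empty , full-right rewrite last≡k =
    Insert.invariant inv empty 1≤k (subst (k ≤_) length≡ k≤) (inj₂ (fill , subst (_< k) (sym fill) mt<k))
                     (λ _ {w} k<w w≤n → full-right w k<w (subst (w ≤_) (sym length≡) w≤n))
    where open Invariant inv

  stage : ℕ → List (Maybe ℕ)
  stage zero    = replicate n nothing
  stage (suc t) with m (suc t) <? m t
  ... | yes _ = setAt (stage t) (m (suc t)) (suc t)
  ... | no  _ = setLast (stage t) (suc t)

  stage-invariant : ∀ t → t ≤ n → Invariant t (stage t)
  stage-invariant zero    _   = initial
  stage-invariant (suc t) t<n with m (suc t) <? m t
  ... | yes peak = peak-step (stage-invariant t (<⇒≤ t<n)) peak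
  ... | no ¬peak = fill-step t<n (stage-invariant t (<⇒≤ t<n)) (≤-antisym (m-≤-pred (suc t)) (≮⇒≥ ¬peak))

  ups : ℕ → ℕ
  ups t = suc n ∸ m t

  -- For a 132-avoiding π, tailPath t (drop t π) is what is left of f π after its t-th down-step.
  tailPath : ℕ → List ℕ → List Step
  tailPath t rest = pathWithUps (ups t) (map (suc n ∸_) (runningMin (m t) rest))

  riAux-stage : ∀ t p → riAux n false (ups t) t (replicate (ups (suc t) ∸ ups t) u ++ d ∷ p) (stage t) ≡
                        riAux n false (ups (suc t)) (suc t) p (stage (suc t))
  riAux-stage t p with m (suc t) <? m t
  ... | yes peak = trans (riAux-peak n t p (stage t) (∸-monoʳ-< peak (m≤1+n t)))
                         (cong (λ a → riAux n false (ups (suc t)) (suc t) p (setAt (stage t) a (suc t)))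
                               (m∸[m∸n]≡n (m≤1+n (suc t))))
  ... | no ¬peak rewrite ≤-antisym (m-≤-pred (suc t)) (≮⇒≥ ¬peak) = riAux-flat n (ups t) t p (stage t)

  riAux-stages : ∀ t rest → drop t π ≡ rest → t + length rest ≡ n →
                 riAux n false (ups t) t (tailPath t rest) (stage t) ≡ stage n
  riAux-stages t []         _     t+0≡n = cong stage (trans (sym (+-identityʳ t)) t+0≡n)
  riAux-stages t (x ∷ rest) drop≡ t+ℓ≡n with drop≡∷⇒at π t drop≡
  ... | at≡x , drop≡′ = begin
    riAux n false (ups t) t (tailPath t (x ∷ rest)) (stage t)
      ≡⟨ cong (λ v → riAux n false (ups t) t
                        (pathWithUps (ups t) (map (suc n ∸_) (v ∷ runningMin v rest))) (stage t))
              (sym (m-suc t at≡x)) ⟩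
    riAux n false (ups t) t (replicate (ups (suc t) ∸ ups t) u ++ d ∷ tailPath (suc t) rest) (stage t)
      ≡⟨ riAux-stage t (tailPath (suc t) rest) ⟩
    riAux n false (ups (suc t)) (suc t) (tailPath (suc t) rest) (stage (suc t))
      ≡⟨ riAux-stages (suc t) rest drop≡′ (trans (sym (+-suc t (length rest))) t+ℓ≡n) ⟩
    stage n ∎
    where open ≡-Reasoning

  KRi≡stage : Avoids132 π → KRi π ≡ map (fromMaybe 0) (stage n)
  KRi≡stage avoids = begin
    Ri (length π) (fAux (length π) π)  ≡⟨ cong (λ k → Ri k (fAux k π)) Π.length≡ ⟩
    Ri n (fAux n π)                    ≡⟨ cong (Ri n) f≡ ⟩
    map (fromMaybe 0) (riAux n false 0 0 (pathWithUps 0 complements) (replicate n nothing))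
      ≡⟨ cong (map (fromMaybe 0)) start ⟩
    map (fromMaybe 0) (stage n)        ∎
    where
    open ≡-Reasoning
    complements : List ℕ
    complements = map (suc n ∸_) (runningMin (suc n) π)
    upCounts≡ : upCounts (suc n) π ≡ complements
    upCounts≡ = map-cong-local (All.tabulate count-above)
      where
      count-above : ∀ {y} → y ∈ runningMin (suc n) π → count≥ y π ≡ suc n ∸ y
      count-above y∈ with runningMin-∈ (suc n) π y∈
      ... | inj₁ refl = IsPerm⇒count≥ perm (suc n) (s≤s z≤n)
      ... | inj₂ y∈π  = IsPerm⇒count≥ perm _ (proj₁ (IsPerm⇒∈-bounded perm y∈π))
    f≡ : fAux n π ≡ pathWithUps 0 complements
    f≡ = trans (fAux≡pathWithUps n π (suc n) (≤-reflexive Π.length≡) (IsPerm⇒Unique perm) avoids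
                              (m≤n⇒m≤1+n ∘ proj₂ ∘ IsPerm⇒∈-bounded perm))
               (cong (pathWithUps 0) upCounts≡)
    start : riAux n false 0 0 (pathWithUps 0 complements) (replicate n nothing) ≡ stage n
    start = subst (λ j → riAux n false j 0 (pathWithUps j complements) (replicate n nothing) ≡ stage n) (n∸n≡0 n)
              (subst (λ v → riAux n false (suc n ∸ v) 0
                                  (pathWithUps (suc n ∸ v) (map (suc n ∸_) (runningMin v π)))
                                  (replicate n nothing) ≡ stage n)
                     (prefixMin-zero (suc n) π) (riAux-stages 0 π refl Π.length≡))

  σ′ : List ℕ
  σ′ = map (fromMaybe 0) (stage n)

  private
    module Final = Invariant (stage-invariant n ≤-refl)

  at-σ′⇒cell : ∀ {w y} → at σ′ w ≡ just y → cell (stage n) w ≡ just y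
  at-σ′⇒cell {w} {y} e with cell (stage n) w in c
  ... | just y′ = trans (sym (cell-just⇒at (stage n) w c)) e
  ... | nothing = contradiction c (filledCount-full (stage n) w (trans Final.filledCount≡ (sym Final.length≡))
                                     (at-just⇒1≤ σ′ w e)
                                     (subst (w ≤_) (length-map _ (stage n)) (at-just⇒≤length σ′ w e)))

  σ′-OneLine : OneLine n σ′
  σ′-OneLine = record
    { length≡   = trans (length-map _ (stage n)) Final.length≡
    ; bounded   = proj₁ ∘ Final.filled ∘ at-σ′⇒cell
    ; onto      = λ 1≤y y≤n → let w , e = Final.complete 1≤y y≤n in w , cell-just⇒at (stage n) w e
    ; injective = λ e e′ → Final.injective (at-σ′⇒cell e) (at-σ′⇒cell e′)
    }

  at-σ′-Peak : ∀ {i} → 1 ≤ i → i ≤ n → Peak i → at σ′ (m i) ≡ just i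
  at-σ′-Peak {i} 1≤i i≤n peak with Final.complete 1≤i i≤n
  ... | w , e with Final.filled e
  ...   | _ , _ , inj₁ (_ , w≡mi) =
    cell-just⇒at (stage n) (m i) (subst (λ v → cell (stage n) v ≡ just i) w≡mi e)
  ...   | _ , _ , inj₂ (fill , _) = contradiction fill (Peak⇒¬Fill peak)

  IsLMin-π⇒σ′ : ∀ {i a} → IsLMin π i a → IsLMin σ′ a i
  IsLMin-π⇒σ′ {i} {a} lmin@(e , _) = subst (λ v → at σ′ v ≡ just i) mi≡a (at-σ′-Peak 1≤i i≤n peak) , i<later
    where
    peak : Peak i
    peak = proj₁ (IsLMin⇒Peak lmin)
    mi≡a : m i ≡ a
    mi≡a = proj₂ (IsLMin⇒Peak lmin)
    1≤i : 1 ≤ i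
    1≤i = proj₁ (Π.positioned e)
    i≤n : i ≤ n
    i≤n = proj₂ (Π.positioned e)
    i<later : ∀ j b → j < a → at σ′ j ≡ just b → i < b
    i<later j b j<a e′ with Final.filled (at-σ′⇒cell e′)
    ... | _ , _ , inj₁ (_ , j≡mb) = ≰⇒> λ b≤i → <⇒≱ j<a (subst₂ _≤_ mi≡a (sym j≡mb) (m-antitone b≤i))
    ... | _ , _ , inj₂ (_ , mb<j) = ≰⇒> λ b≤i → <⇒≱ (<-trans mb<j j<a) (subst (_≤ m b) mi≡a (m-antitone b≤i))

  IsLMin-σ′⇒π : ∀ {a i} → IsLMin σ′ a i → IsLMin π i a
  IsLMin-σ′⇒π {a} {i} (e , i<later) with Final.filled (at-σ′⇒cell e)
  ... | (1≤i , i≤n) , _ , inj₁ (peak , a≡mi) = subst (IsLMin π i) (sym a≡mi) (Peak⇒IsLMin 1≤i i≤n peak)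
  ... | (1≤i , i≤n) , _ , inj₂ (_ , mi<a) with last-Peak i 1≤i i≤n
  ...   | y , 1≤y , y≤i , my≡mi , peak = contradiction
    (i<later (m y) y (subst (_< a) (sym my≡mi) mi<a) (at-σ′-Peak 1≤y (≤-trans y≤i i≤n) peak)) (≤⇒≯ y≤i)

  σ′-DecreasingOffLMin : DecreasingOffLMin σ′
  σ′-DecreasingOffLMin {w} {w′} {y} {y′} w<w′ e e′ ¬lmin ¬lmin′ with <-cmp y′ y
  ... | tri< y′<y _ _ = y′<y
  ... | tri≈ _ refl _ = contradiction (OneLine.injective σ′-OneLine e e′) (<⇒≢ w<w′)
  ... | tri> _ _ y<y′ = contradiction
    (Final.fills-decrease (at-σ′⇒cell e) (at-σ′⇒cell e′) (off-LMin⇒Fill e ¬lmin) (off-LMin⇒Fill e′ ¬lmin′) y<y′)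
    (<⇒≯ w<w′)
    where
    off-LMin⇒Fill : ∀ {v z} → at σ′ v ≡ just z → ¬ IsLMin σ′ v z → Fill z
    off-LMin⇒Fill e″ ¬lmin″ with Final.filled (at-σ′⇒cell e″)
    ... | (1≤z , z≤) , _ , inj₁ (peak , refl) = contradiction (IsLMin-π⇒σ′ (Peak⇒IsLMin 1≤z z≤ peak)) ¬lmin″
    ... | _ , _ , inj₂ (fill , _)              = fill

lemma8 : (n : ℕ) → 1 ≤ n → (π σ : List ℕ) →
         IsPerm n π → Avoids132 π → IsPerm n σ → Avoids123 σ →
         (KRi π ≡ σ ⇔ (∀ i a → 1 ≤ i → i ≤ n → 1 ≤ a → a ≤ n →
                        (IsLMin π i a ⇔ IsLMin σ a i)))
lemma8 n _ π σ π-perm π-avoids σ-perm σ-avoids = mk⇔ to from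
  where
  open Richards π-perm
  σ-line : OneLine n σ
  σ-line = IsPerm⇒OneLine σ-perm

  to : KRi π ≡ σ → ∀ i a → 1 ≤ i → i ≤ n → 1 ≤ a → a ≤ n → (IsLMin π i a ⇔ IsLMin σ a i)
  to KRi≡σ i a _ _ _ _ = subst (λ τ → IsLMin π i a ⇔ IsLMin τ a i) (trans (sym (KRi≡stage π-avoids)) KRi≡σ)
                               (mk⇔ IsLMin-π⇒σ′ IsLMin-σ′⇒π)

  from : (∀ i a → 1 ≤ i → i ≤ n → 1 ≤ a → a ≤ n → (IsLMin π i a ⇔ IsLMin σ a i)) → KRi π ≡ σ
  from transposed = trans (KRi≡stage π-avoids)
    (OneLine-LMin-unique σ′-OneLine σ-line same
                         σ′-DecreasingOffLMin (Avoids123⇒DecreasingOffLMin σ-line σ-avoids))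
    where
    transposed′ : ∀ i a → IsLMin π i a ⇔ IsLMin σ a i
    transposed′ = LMin-bounds-redundant (IsPerm⇒OneLine π-perm) σ-line transposed
    same : ∀ w y → IsLMin σ′ w y ⇔ IsLMin σ w y
    same w y = mk⇔ (Equivalence.to (transposed′ y w) ∘ IsLMin-σ′⇒π)
                   (IsLMin-π⇒σ′ ∘ Equivalence.from (transposed′ y w))
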